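{- Partitions $\mu$ and $\nu$ of $n$ are rook equivalent if and only if $\mathcal{S}_\mu=\mathcal{S}_\nu$.
   Context: A partition is an infinite weakly decreasing sequence $\mu_1\ge\mu_2\ge\cdots$ of nonnegative integers with finitely many nonzero terms, identified with its Ferrers board. Two partitions are rook equivalent if for every $k\ge0$ they have the same number of placements of $k$ non-attacking rooks (no two in the same row or column). Row $i$ ($i\ge1$) of $\mu$ is salient if there exists $j>i$ with $i+\mu_i\ge j+\mu_j$. $\mathcal{S}_\mu$ is the multiset $\{i+\mu_i:\text{row } i\text{ is salient in }\mu\}$ (with multiplicity). -}

module Defs where

open import Data.Nat using (ℕ; zero; suc; _+_; _≤_; _<_; _≡ᵇ_; s≤s)
open import Data.Nat.Properties using (_≟_; _≤?_; _<?_; anyUpTo?; ≤-trans; m≤m+n; ≤-refl; n<1+n)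
open import Data.Bool using (Bool; true; false; _∧_; not)
open import Data.List using (List; []; _∷_; _++_; map; length; filter; concatMap; upTo)
open import Data.Nat.ListAction using (sum)
open import Data.List.Relation.Unary.All using (All)
open import Data.Product using (Σ; ∃; _×_; _,_; proj₁; proj₂)
open import Relation.Nullary using (Dec; yes; no; ¬_)
open import Relation.Nullary.Decidable using (map′; _×-dec_)
open import Relation.Nullary.Decidable.Core using (T?)
open import Relation.Binary.PropositionalEquality using (_≡_)

-- Partitions.  A partition μ₁ ≥ μ₂ ≥ ⋯ is stored by its list of
-- nonzero parts [μ₁, …, μ_ℓ]; μ_i = 0 for i > ℓ.

-- part xs i = the i-th entry (1-indexed), 0 beyond the end (and at i = 0,
-- which is never used as a row index).
part : List ℕ → ℕ → ℕ
part []       _             = 0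
part (x ∷ xs) zero          = 0
part (x ∷ xs) (suc zero)    = x
part (x ∷ xs) (suc (suc i)) = part xs (suc i)

record Partition : Set where
  field
    parts      : List ℕ
    positive   : All (λ x → 1 ≤ x) parts
    decreasing : ∀ i → 1 ≤ i → part parts (suc i) ≤ part parts i

open Partition public

_⟦_⟧ : Partition → ℕ → ℕ
μ ⟦ i ⟧ = part (parts μ) i

len : Partition → ℕ
len μ = length (parts μ)

_⊢_ : Partition → ℕ → Set
μ ⊢ n = sum (parts μ) ≡ n

Cell : Set
Cell = ℕ × ℕ

oneTo : ℕ → List ℕ
oneTo m = map suc (upTo m)

board : Partition → List Cell
board μ = concatMap (λ i → map (λ j → (i , j)) (oneTo (μ ⟦ i ⟧))) (oneTo (len μ))

subsets : {A : Set} → List A → List (List A)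
subsets []       = [] ∷ []
subsets (x ∷ xs) = map (x ∷_) (subsets xs) ++ subsets xs

nonAttacking : List Cell → Bool
nonAttacking []       = true
nonAttacking (c ∷ cs) = allOk cs ∧ nonAttacking cs
  where
  allOk : List Cell → Bool
  allOk []       = true
  allOk (d ∷ ds) = not (proj₁ c ≡ᵇ proj₁ d) ∧ not (proj₂ c ≡ᵇ proj₂ d) ∧ allOk ds

rookNumber : ℕ → Partition → ℕ
rookNumber k μ =
  length (filter (λ S → T? ((length S ≡ᵇ k) ∧ nonAttacking S)) (subsets (board μ)))

RookEquivalent : Partition → Partition → Set
RookEquivalent μ ν = ∀ k → rookNumber k μ ≡ rookNumber k ν

Salient : Partition → ℕ → Set
Salient μ i = ∃ λ j → i < j × j + μ ⟦ j ⟧ ≤ i + μ ⟦ i ⟧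

-- decidable by bounded search: any witness j satisfies j ≤ i + μ_i
salient? : (μ : Partition) → (i : ℕ) → Dec (Salient μ i)
salient? μ i =
  map′ (λ { (j , _ , p) → j , p })
       (λ { (j , i<j , le) → j , s≤s (≤-trans (m≤m+n j (μ ⟦ j ⟧)) le) , i<j , le })
       (anyUpTo? (λ j → (i <? j) ×-dec (j + μ ⟦ j ⟧ ≤? i + μ ⟦ i ⟧)) (suc (i + μ ⟦ i ⟧)))

-- 𝒮_μ = {i + μ_i : row i salient}, as a list (multiset up to permutation).
-- Rows i > ℓ(μ) are never salient (μ_i = 0, and j + μ_j ≥ j > i), so it
-- suffices to range over rows 1 … ℓ(μ).
𝒮 : Partition → List ℕ
𝒮 μ = map (λ i → i + μ ⟦ i ⟧) (filter (salient? μ) (oneTo (len μ)))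

-- Fix m larger than the number of rows of μ and ν and let 𝒯 μ m be the
-- multiset {i + μ_i : 1 ≤ i ≤ m}.  The theorem is the composite of
--   (1) μ, ν rook equivalent  ⇔  𝒯 μ m = 𝒯 ν m,   and
--   (2) 𝒯 μ m = 𝒯 ν m  ⇔  𝒮 μ = 𝒮 ν.
-- For (1), the rook numbers obey a row recursion (RookNumbers) which
-- expresses them as a symmetric function Z of the integers i + μ_i − m
-- (Factorisation, RookNumbersVia𝒯), giving "⇐"; by the factorisation theorem
-- of Goldman, Joichi and White they determine the products ∏_{a ∈ 𝒯 μ m} (y + a),
-- and these products determine the multiset 𝒯 μ m (ProductsDetermineMultisets),
-- giving "⇒".  For (2), 𝒯 μ m is 𝒮 μ together with the interval
-- [min 𝒯 μ m, …, m] (SalientDecomposition).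
module Submission where

open import Defs
open import Data.Nat using (ℕ)
open import Function.Bundles using (_⇔_)
open import Data.List.Relation.Binary.Permutation.Propositional using (_↭_)

module Basics where

  open import Data.Nat using (ℕ; zero; suc; _+_; _*_; _∸_; _≤_; _<_; s≤s; z≤n)
  open import Data.Nat.Properties
  open import Data.Bool using (Bool; true; false)
  open import Data.List using (List; []; _∷_; _++_; map; length; applyUpTo; filter)
  open import Data.List.Relation.Unary.All using (All; []; _∷_) renaming (map to mapAll)
  open import Data.Product using (_×_; _,_)
  open import Data.Sum using (inj₁; inj₂)
  open import Relation.Binary.PropositionalEquality
  open import Function using (_∘_; id)
  open import Relation.Nullary.Decidable.Core using (T?)
  open import Algebra.Properties.CommutativeSemigroup +-commutativeSemigroup using (interchange)
  open import Data.List.Properties using (length-map)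

  part-beyond : ∀ (μ : Partition) {i} → len μ < i → μ ⟦ i ⟧ ≡ 0
  part-beyond μ = go (parts μ)
    where
    go : ∀ xs {i} → length xs < i → part xs i ≡ 0
    go []       _                      = refl
    go (x ∷ xs) {suc zero}    (s≤s ())
    go (x ∷ xs) {suc (suc i)} (s≤s ℓ<i) = go xs ℓ<i

  part-antitone : ∀ (μ : Partition) {i j} → 1 ≤ i → i ≤ j → μ ⟦ j ⟧ ≤ μ ⟦ i ⟧
  part-antitone μ 1≤i i≤j with m≤n⇒m<n∨m≡n i≤j
  ... | inj₂ refl        = ≤-refl
  ... | inj₁ (s≤s i≤j′) =
    ≤-trans (decreasing μ _ (≤-trans 1≤i i≤j′)) (part-antitone μ 1≤i i≤j′)

  range : ℕ → ℕ → List ℕ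
  range c zero    = []
  range c (suc n) = c ∷ range (suc c) n

  length-range : ∀ c n → length (range c n) ≡ n
  length-range c zero    = refl
  length-range c (suc n) = cong suc (length-range (suc c) n)

  range-bounds : ∀ c n → All (λ j → c ≤ j × j < c + n) (range c n)
  range-bounds c zero    = []
  range-bounds c (suc n) =
    (≤-refl , m<m+n c (s≤s z≤n)) ∷ mapAll widen (range-bounds (suc c) n)
    where
    widen : ∀ {j} → suc c ≤ j × j < suc c + n → c ≤ j × j < c + suc n
    widen {j} (c<j , j<) = <⇒≤ c<j , subst (j <_) (sym (+-suc c n)) j<

  range-++ : ∀ c n e → range c (n + e) ≡ range c n ++ range (c + n) e
  range-++ c zero    e = cong (λ d → range d e) (sym (+-identityʳ c))
  range-++ c (suc n) e = cong (c ∷_) (begin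
    range (suc c) (n + e)                   ≡⟨ range-++ (suc c) n e ⟩
    range (suc c) n ++ range (suc c + n) e  ≡⟨ cong (λ d → range (suc c) n ++ range d e) (sym (+-suc c n)) ⟩
    range (suc c) n ++ range (c + suc n) e  ∎)
    where open ≡-Reasoning

  range-split : ∀ {ℓ m} → ℓ ≤ m → range 1 m ≡ range 1 ℓ ++ range (suc ℓ) (m ∸ ℓ)
  range-split {ℓ} {m} ℓ≤m =
    trans (cong (range 1) (sym (m+[n∸m]≡n ℓ≤m))) (range-++ 1 ℓ (m ∸ ℓ))

  oneTo≡range : ∀ n → oneTo n ≡ range 1 n
  oneTo≡range n = go suc id 1 n (λ _ → refl)
    where
    go : ∀ (h g : ℕ → ℕ) c n → (∀ i → h (g i) ≡ c + i) → map h (applyUpTo g n) ≡ range c n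
    go h g c zero    eq = refl
    go h g c (suc n) eq =
      cong₂ _∷_ (trans (eq 0) (+-identityʳ c)) (go h (g ∘ suc) (suc c) n (λ i → trans (eq (suc i)) (+-suc c i)))

  𝒯 : Partition → ℕ → List ℕ
  𝒯 μ m = map (λ i → i + μ ⟦ i ⟧) (range 1 m)

  length-𝒯 : ∀ μ m → length (𝒯 μ m) ≡ m
  length-𝒯 μ m = trans (length-map _ (range 1 m)) (length-range 1 m)

  sumOver : {A : Set} → (A → ℕ) → List A → ℕ
  sumOver f []       = 0
  sumOver f (x ∷ xs) = f x + sumOver f xs

  ind : Bool → ℕ
  ind true  = 1
  ind false = 0

  count : {A : Set} → (A → Bool) → List A → ℕ
  count p = sumOver (ind ∘ p)

  module _ {A : Set} where

    sumOver-++ : ∀ (f : A → ℕ) xs ys → sumOver f (xs ++ ys) ≡ sumOver f xs + sumOver f ys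
    sumOver-++ f []       ys = refl
    sumOver-++ f (x ∷ xs) ys = trans (cong (f x +_) (sumOver-++ f xs ys)) (sym (+-assoc (f x) _ _))

    sumOver-map : ∀ {B : Set} (f : B → ℕ) (g : A → B) xs → sumOver f (map g xs) ≡ sumOver (f ∘ g) xs
    sumOver-map f g []       = refl
    sumOver-map f g (x ∷ xs) = cong (f (g x) +_) (sumOver-map f g xs)

    sumOver-cong : ∀ {f g : A → ℕ} xs → All (λ x → f x ≡ g x) xs → sumOver f xs ≡ sumOver g xs
    sumOver-cong []       []         = refl
    sumOver-cong (x ∷ xs) (e ∷ es) = cong₂ _+_ e (sumOver-cong xs es)

    sumOver-zero : ∀ (xs : List A) → sumOver (λ _ → 0) xs ≡ 0
    sumOver-zero []       = refl
    sumOver-zero (x ∷ xs) = sumOver-zero xs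

    sumOver-+ : ∀ (f g : A → ℕ) xs → sumOver (λ x → f x + g x) xs ≡ sumOver f xs + sumOver g xs
    sumOver-+ f g []       = refl
    sumOver-+ f g (x ∷ xs) =
      trans (cong (f x + g x +_) (sumOver-+ f g xs)) (interchange (f x) (g x) _ _)

    sumOver-*ʳ : ∀ (f : A → ℕ) c xs → sumOver (λ x → f x * c) xs ≡ sumOver f xs * c
    sumOver-*ʳ f c []       = refl
    sumOver-*ʳ f c (x ∷ xs) =
      trans (cong (f x * c +_) (sumOver-*ʳ f c xs)) (sym (*-distribʳ-+ c (f x) (sumOver f xs)))

    count-true : ∀ (xs : List A) → count (λ _ → true) xs ≡ length xs
    count-true []       = refl
    count-true (x ∷ xs) = cong suc (count-true xs)

  sumOver-swap : ∀ {A B : Set} (h : A → B → ℕ) (xs : List A) (ys : List B) →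
    sumOver (λ x → sumOver (h x) ys) xs ≡ sumOver (λ y → sumOver (λ x → h x y) xs) ys
  sumOver-swap h xs []       = sumOver-zero xs
  sumOver-swap h xs (y ∷ ys) =
    trans (sumOver-+ (λ x → h x y) (λ x → sumOver (h x) ys) xs)
          (cong (sumOver (λ x → h x y) xs +_) (sumOver-swap h xs ys))

  length-filter : ∀ {A : Set} (p : A → Bool) xs → length (filter (T? ∘ p) xs) ≡ count p xs
  length-filter p []       = refl
  length-filter p (x ∷ xs) with p x
  ... | true  = cong suc (length-filter p xs)
  ... | false = length-filter p xs

-- The rook numbers of a Ferrers board obey the row recursion
--   r_{k+1}(b ∷ bs) = (b ∸ k) · r_k(bs) + r_{k+1}(bs)
-- (bs the rows below a top row of length b): a placement of k + 1 rooks
-- either avoids the top row, or is a placement of k rooks below together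
-- with one of the b − k columns of the top row they leave free.
module RookNumbers where

  open import Data.Nat using (ℕ; zero; suc; _+_; _*_; _∸_; _≤_; _<_; _≡ᵇ_; s≤s; s≤s⁻¹)
  open import Data.Nat.Properties
  open import Data.Bool using (Bool; true; false; _∧_; not)
  open import Data.Bool.Properties using (∧-assoc; ∧-comm; ∧-identityʳ; ∧-zeroʳ; ∧-conicalˡ; ∧-conicalʳ; T-≡; ¬-not)
  open import Data.List using (List; []; _∷_; _++_; map; length; concatMap)
  open import Data.List.Properties using (++-assoc; concatMap-cong; ++-identityʳ)
  open import Data.List.Relation.Unary.All using (All; []; _∷_; universal) renaming (map to mapAll)
  open import Data.List.Relation.Unary.All.Properties using (++⁺; map⁺)
  open import Data.Product using (_×_; _,_; proj₁; proj₂)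
  open import Data.Empty using (⊥-elim)
  open import Relation.Nullary using (yes; no)
  open import Relation.Binary.PropositionalEquality
  open import Function using (_∘_; Equivalence)
  open Basics

  ≡ᵇ-refl : ∀ n → (n ≡ᵇ n) ≡ true
  ≡ᵇ-refl n = Equivalence.to T-≡ (≡⇒≡ᵇ n n refl)

  ≢⇒≡ᵇ-false : ∀ {m n} → m ≢ n → (m ≡ᵇ n) ≡ false
  ≢⇒≡ᵇ-false {m} {n} m≢n = ¬-not (λ eq → m≢n (≡ᵇ⇒≡ m n (Equivalence.from T-≡ eq)))

  compatible : Cell → List Cell → Bool
  compatible c []       = true
  compatible c (d ∷ ds) = not (proj₁ c ≡ᵇ proj₁ d) ∧ not (proj₂ c ≡ᵇ proj₂ d) ∧ compatible c ds

  nonAttacking-∷ : ∀ c cs → nonAttacking (c ∷ cs) ≡ compatible c cs ∧ nonAttacking cs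
  nonAttacking-∷ c []       = refl
  nonAttacking-∷ c (d ∷ ds) =
    agree-under (not (proj₁ c ≡ᵇ proj₁ d)) (not (proj₂ c ≡ᵇ proj₂ d)) _ (compatible c ds) _ (nonAttacking ds)
                (nonAttacking-∷ c ds)
    where
    agree-under : ∀ p q a b r n → a ∧ n ≡ b ∧ n → (p ∧ q ∧ a) ∧ (r ∧ n) ≡ (p ∧ q ∧ b) ∧ (r ∧ n)
    agree-under p q a b r true  a≡b =
      cong (λ z → (p ∧ q ∧ z) ∧ (r ∧ true)) (trans (sym (∧-identityʳ a)) (trans a≡b (∧-identityʳ b)))
    agree-under p q a b r false _ rewrite ∧-zeroʳ r | ∧-zeroʳ (p ∧ q ∧ a) | ∧-zeroʳ (p ∧ q ∧ b) = refl

  isPlacement : ℕ → List Cell → Bool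
  isPlacement k S = (length S ≡ᵇ k) ∧ nonAttacking S

  rooks : ℕ → List Cell → ℕ
  rooks k L = count (isPlacement k) (subsets L)

  rookNumber≡rooks : ∀ k μ → rookNumber k μ ≡ rooks k (board μ)
  rookNumber≡rooks k μ = length-filter (isPlacement k) (subsets (board μ))

  count-subsets-∷ : ∀ {A : Set} (p : List A → Bool) x L →
    count p (subsets (x ∷ L)) ≡ count (p ∘ (x ∷_)) (subsets L) + count p (subsets L)
  count-subsets-∷ p x L =
    trans (sumOver-++ (ind ∘ p) (map (x ∷_) (subsets L)) (subsets L))
          (cong (_+ count p (subsets L)) (sumOver-map (ind ∘ p) (x ∷_) (subsets L)))

  subsets-All : ∀ {A : Set} {P : A → Set} L → All P L → All (All P) (subsets L)
  subsets-All []      []         = [] ∷ []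
  subsets-All (x ∷ L) (px ∷ pL) =
    ++⁺ (map⁺ (mapAll (px ∷_) (subsets-All L pL))) (subsets-All L pL)

  rooks-zero : ∀ L → rooks 0 L ≡ 1
  rooks-zero []      = refl
  rooks-zero (x ∷ L) =
    trans (count-subsets-∷ (isPlacement 0) x L) (cong₂ _+_ (sumOver-zero (subsets L)) (rooks-zero L))

  extensions : ℕ → Cell → List Cell → ℕ
  extensions k x L = count (λ S → isPlacement k S ∧ compatible x S) (subsets L)

  rooks-∷ : ∀ k x L → rooks (suc k) (x ∷ L) ≡ extensions k x L + rooks (suc k) L
  rooks-∷ k x L =
    trans (count-subsets-∷ (isPlacement (suc k)) x L)
          (cong (_+ rooks (suc k) L) (sumOver-cong (subsets L) (universal (cong ind ∘ split) (subsets L))))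
    where
    split : ∀ S → isPlacement (suc k) (x ∷ S) ≡ isPlacement k S ∧ compatible x S
    split S = begin
      (length S ≡ᵇ k) ∧ nonAttacking (x ∷ S)               ≡⟨ cong ((length S ≡ᵇ k) ∧_) (nonAttacking-∷ x S) ⟩
      (length S ≡ᵇ k) ∧ (compatible x S ∧ nonAttacking S)  ≡⟨ cong ((length S ≡ᵇ k) ∧_) (∧-comm (compatible x S) _) ⟩
      (length S ≡ᵇ k) ∧ (nonAttacking S ∧ compatible x S)  ≡⟨ sym (∧-assoc (length S ≡ᵇ k) _ _) ⟩
      isPlacement k S ∧ compatible x S                     ∎
      where open ≡-Reasoning

  -- No placement containing y extends by a rook in the row of y.
  extensions-sameRow : ∀ k x y L → proj₁ x ≡ proj₁ y → extensions k x (y ∷ L) ≡ extensions k x L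
  extensions-sameRow k x y L sameRow =
    trans (count-subsets-∷ _ y L)
          (cong (_+ extensions k x L)
                (trans (sumOver-cong (subsets L) (universal (cong ind ∘ excluded) (subsets L)))
                       (sumOver-zero (subsets L))))
    where
    excluded : ∀ S → isPlacement k (y ∷ S) ∧ compatible x (y ∷ S) ≡ false
    excluded S rewrite sameRow | ≡ᵇ-refl (proj₁ y) = ∧-zeroʳ (isPlacement k (y ∷ S))

  rooks-row : ∀ k s J L →
    rooks (suc k) (map (s ,_) J ++ L) ≡ sumOver (λ j → extensions k (s , j) L) J + rooks (suc k) L
  rooks-row k s []      L = refl
  rooks-row k s (j ∷ J) L = begin
    rooks (suc k) ((s , j) ∷ map (s ,_) J ++ L)
      ≡⟨ rooks-∷ k (s , j) (map (s ,_) J ++ L) ⟩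
    extensions k (s , j) (map (s ,_) J ++ L) + rooks (suc k) (map (s ,_) J ++ L)
      ≡⟨ cong₂ _+_ (ignoreRow J) (rooks-row k s J L) ⟩
    extensions k (s , j) L + (sumOver (λ j → extensions k (s , j) L) J + rooks (suc k) L)
      ≡⟨ sym (+-assoc (extensions k (s , j) L) _ _) ⟩
    sumOver (λ j → extensions k (s , j) L) (j ∷ J) + rooks (suc k) L ∎
    where
    open ≡-Reasoning
    ignoreRow : ∀ J → extensions k (s , j) (map (s ,_) J ++ L) ≡ extensions k (s , j) L
    ignoreRow []        = refl
    ignoreRow (j′ ∷ J) = trans (extensions-sameRow k (s , j) (s , j′) (map (s ,_) J ++ L) refl) (ignoreRow J)

  count-delete : ∀ (g : ℕ → Bool) c n x → c ≤ x → x < c + n →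
    count (λ j → not (j ≡ᵇ x) ∧ g j) (range c n) + ind (g x) ≡ count g (range c n)
  count-delete g c zero    x c≤x x<c = ⊥-elim (<⇒≱ (subst (x <_) (+-identityʳ c) x<c) c≤x)
  count-delete g c (suc n) x c≤x x<c+n with c ≟ x
  ... | yes refl rewrite ≡ᵇ-refl c =
    trans (cong (_+ ind (g c)) (sumOver-cong (range (suc c) n) (mapAll keep (range-bounds (suc c) n))))
          (+-comm (count g (range (suc c) n)) (ind (g c)))
    where
    keep : ∀ {j} → suc c ≤ j × j < suc c + n → ind (not (j ≡ᵇ c) ∧ g j) ≡ ind (g j)
    keep (c<j , _) rewrite ≢⇒≡ᵇ-false (>⇒≢ c<j) = refl
  ... | no c≢x rewrite ≢⇒≡ᵇ-false c≢x =
    trans (+-assoc (ind (g c)) _ _)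
          (cong (ind (g c) +_) (count-delete g (suc c) n x (≤∧≢⇒< c≤x c≢x) (subst (x <_) (+-suc c n) x<c+n)))

  compatible-moveRow : ∀ s d S → compatible d S ≡ true → All (λ e → proj₁ e ≢ s) S →
    compatible (s , proj₂ d) S ≡ true
  compatible-moveRow s d []      _  _                = refl
  compatible-moveRow s d (e ∷ S) ok (e≢s ∷ offRow) =
    cong₂ _∧_ (cong not (≢⇒≡ᵇ-false (≢-sym e≢s)))
              (cong₂ _∧_ (∧-conicalˡ _ _ ok′) (compatible-moveRow s d S (∧-conicalʳ _ _ ok′) offRow))
    where
    ok′ : not (proj₂ d ≡ᵇ proj₂ e) ∧ compatible d S ≡ true
    ok′ = ∧-conicalʳ (not (proj₁ d ≡ᵇ proj₁ e)) _ ok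

  OffRow : ℕ → ℕ → Cell → Set
  OffRow s b c = proj₁ c ≢ s × 1 ≤ proj₂ c × proj₂ c ≤ b

  free-columns : ∀ s b S → All (OffRow s b) S → nonAttacking S ≡ true →
    count (λ j → compatible (s , j) S) (range 1 b) + length S ≡ b
  free-columns s b []      _ _ = trans (+-identityʳ _) (trans (count-true (range 1 b)) (length-range 1 b))
  free-columns s b (d ∷ S) ((d≢s , 1≤d , d≤b) ∷ offRow) na = begin
    count (λ j → compatible (s , j) (d ∷ S)) cols + suc (length S)
      ≡⟨ cong (_+ suc (length S)) (sumOver-cong cols (universal (cong ind ∘ otherRow) cols)) ⟩
    others + suc (length S)                   ≡⟨ cong (λ z → others + (ind z + length S)) (sym dFree) ⟩
    others + (ind (g (proj₂ d)) + length S)   ≡⟨ sym (+-assoc others _ _) ⟩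
    others + ind (g (proj₂ d)) + length S     ≡⟨ cong (_+ length S) (count-delete g 1 b (proj₂ d) 1≤d (s≤s d≤b)) ⟩
    count g cols + length S                   ≡⟨ free-columns s b S offRow (∧-conicalʳ _ _ na′) ⟩
    b                                         ∎
    where
    open ≡-Reasoning
    cols = range 1 b
    g : ℕ → Bool
    g j = compatible (s , j) S
    others = count (λ j → not (j ≡ᵇ proj₂ d) ∧ g j) cols
    na′ : compatible d S ∧ nonAttacking S ≡ true
    na′ = trans (sym (nonAttacking-∷ d S)) na
    otherRow : ∀ j → compatible (s , j) (d ∷ S) ≡ not (j ≡ᵇ proj₂ d) ∧ g j
    otherRow j = cong (λ z → not z ∧ not (j ≡ᵇ proj₂ d) ∧ g j) (≢⇒≡ᵇ-false (≢-sym d≢s))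
    dFree : g (proj₂ d) ≡ true
    dFree = compatible-moveRow s d S (∧-conicalˡ _ _ na′) (mapAll proj₁ offRow)

  extensions-of : ∀ k s b S → All (OffRow s b) S →
    count (λ j → isPlacement k S ∧ compatible (s , j) S) (range 1 b) ≡ ind (isPlacement k S) * (b ∸ k)
  extensions-of k s b S offRow with isPlacement k S in placed
  ... | false = sumOver-zero (range 1 b)
  ... | true  = begin
    free                   ≡⟨ sym (m+n∸n≡m free k) ⟩
    free + k ∸ k           ≡⟨ cong (λ z → free + z ∸ k) (sym size) ⟩
    free + length S ∸ k    ≡⟨ cong (_∸ k) (free-columns s b S offRow (∧-conicalʳ _ _ placed)) ⟩
    b ∸ k                  ≡⟨ sym (+-identityʳ (b ∸ k)) ⟩
    1 * (b ∸ k)            ∎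
    where
    open ≡-Reasoning
    free = count (λ j → compatible (s , j) S) (range 1 b)
    size : length S ≡ k
    size = ≡ᵇ⇒≡ (length S) k (Equivalence.from T-≡ (∧-conicalˡ _ _ placed))

  -- Double counting the pairs (placement on L, free column of row s).
  sum-extensions : ∀ k s b L → All (OffRow s b) L →
    sumOver (λ j → extensions k (s , j) L) (range 1 b) ≡ (b ∸ k) * rooks k L
  sum-extensions k s b L offRow = begin
    sumOver (λ j → extensions k (s , j) L) (range 1 b)
      ≡⟨ sumOver-swap (λ j S → ind (isPlacement k S ∧ compatible (s , j) S)) (range 1 b) (subsets L) ⟩
    sumOver (λ S → count (λ j → isPlacement k S ∧ compatible (s , j) S) (range 1 b)) (subsets L)
      ≡⟨ sumOver-cong (subsets L) (mapAll (extensions-of k s b _) (subsets-All L offRow)) ⟩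
    sumOver (λ S → ind (isPlacement k S) * (b ∸ k)) (subsets L)
      ≡⟨ sumOver-*ʳ (ind ∘ isPlacement k) (b ∸ k) (subsets L) ⟩
    rooks k L * (b ∸ k)
      ≡⟨ *-comm (rooks k L) (b ∸ k) ⟩
    (b ∸ k) * rooks k L ∎
    where open ≡-Reasoning

  rooks-addRow : ∀ k s b L → All (OffRow s b) L →
    rooks (suc k) (map (s ,_) (range 1 b) ++ L) ≡ (b ∸ k) * rooks k L + rooks (suc k) L
  rooks-addRow k s b L offRow =
    trans (rooks-row k s (range 1 b) L) (cong (_+ rooks (suc k) L) (sum-extensions k s b L offRow))

  cellsOf : (ℕ → ℕ) → List ℕ → List Cell
  cellsOf f rs = concatMap (λ i → map (i ,_) (range 1 (f i))) rs

  cellsOf-++ : ∀ f rs rs′ → cellsOf f (rs ++ rs′) ≡ cellsOf f rs ++ cellsOf f rs′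
  cellsOf-++ f []       rs′ = refl
  cellsOf-++ f (i ∷ rs) rs′ =
    trans (cong (map (i ,_) (range 1 (f i)) ++_) (cellsOf-++ f rs rs′)) (sym (++-assoc (map (i ,_) (range 1 (f i))) _ _))

  cellsOf-bounds : ∀ f c n →
    All (λ cell → c ≤ proj₁ cell × 1 ≤ proj₂ cell × proj₂ cell ≤ f (proj₁ cell)) (cellsOf f (range c n))
  cellsOf-bounds f c zero    = []
  cellsOf-bounds f c (suc n) =
    ++⁺ (map⁺ (mapAll (λ (1≤j , j≤) → ≤-refl , 1≤j , s≤s⁻¹ j≤) (range-bounds 1 (f c))))
        (mapAll (λ (c<i , inRow) → <⇒≤ c<i , inRow) (cellsOf-bounds f (suc c) n))

  -- Rows of length zero contain no cells, so the board of μ is its board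
  -- over any rows 1 … m with m ≥ ℓ(μ).
  board≡cellsOf : ∀ μ {m} → len μ ≤ m → board μ ≡ cellsOf (μ ⟦_⟧) (range 1 m)
  board≡cellsOf μ {m} ℓ≤m = begin
    board μ                                                 ≡⟨ board≡ ⟩
    cellsOf f (range 1 ℓ)                                   ≡⟨ sym (++-identityʳ _) ⟩
    cellsOf f (range 1 ℓ) ++ []                             ≡⟨ cong (cellsOf f (range 1 ℓ) ++_) (sym (empty (suc ℓ) (m ∸ ℓ) ≤-refl)) ⟩
    cellsOf f (range 1 ℓ) ++ cellsOf f (range (suc ℓ) (m ∸ ℓ)) ≡⟨ sym (cellsOf-++ f (range 1 ℓ) _) ⟩
    cellsOf f (range 1 ℓ ++ range (suc ℓ) (m ∸ ℓ))           ≡⟨ cong (cellsOf f) (sym (range-split ℓ≤m)) ⟩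
    cellsOf f (range 1 m)                                   ∎
    where
    open ≡-Reasoning
    f = μ ⟦_⟧
    ℓ = len μ
    board≡ : board μ ≡ cellsOf f (range 1 ℓ)
    board≡ = trans (concatMap-cong (λ i → cong (map (i ,_)) (oneTo≡range (f i))) (oneTo ℓ))
                   (cong (cellsOf f) (oneTo≡range ℓ))
    empty : ∀ c e → ℓ < c → cellsOf f (range c e) ≡ []
    empty c zero    ℓ<c = refl
    empty c (suc e) ℓ<c rewrite part-beyond μ ℓ<c = empty (suc c) e (m<n⇒m<1+n ℓ<c)

  -- r_k of the Ferrers board with row lengths bs (listed top to bottom),
  -- computed by the row recursion.
  ferrersRooks : List ℕ → ℕ → ℕ
  ferrersRooks bs       zero    = 1
  ferrersRooks []       (suc k) = 0
  ferrersRooks (b ∷ bs) (suc k) = (b ∸ k) * ferrersRooks bs k + ferrersRooks bs (suc k)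

  Antitone : (ℕ → ℕ) → Set
  Antitone f = ∀ {i j} → 1 ≤ i → i ≤ j → f j ≤ f i

  rooks-cellsOf : ∀ f → Antitone f → ∀ c n → 1 ≤ c → ∀ k →
    rooks k (cellsOf f (range c n)) ≡ ferrersRooks (map f (range c n)) k
  rooks-cellsOf f anti c n       1≤c zero    = rooks-zero (cellsOf f (range c n))
  rooks-cellsOf f anti c zero    1≤c (suc k) = refl
  rooks-cellsOf f anti c (suc n) 1≤c (suc k) =
    trans (rooks-addRow k c (f c) below offRow)
          (cong₂ _+_ (cong ((f c ∸ k) *_) (rooks-cellsOf f anti (suc c) n (m≤n⇒m≤1+n 1≤c) k))
                     (rooks-cellsOf f anti (suc c) n (m≤n⇒m≤1+n 1≤c) (suc k)))
    where
    below = cellsOf f (range (suc c) n)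
    offRow : All (OffRow c (f c)) below
    offRow = mapAll (λ (c<i , 1≤j , j≤fi) → >⇒≢ c<i , 1≤j , ≤-trans j≤fi (anti 1≤c (<⇒≤ c<i)))
                    (cellsOf-bounds f (suc c) n)

  rowLengths : Partition → ℕ → List ℕ
  rowLengths μ m = map (μ ⟦_⟧) (range 1 m)

  rookNumber≡ferrersRooks : ∀ μ {m} → len μ ≤ m → ∀ k → rookNumber k μ ≡ ferrersRooks (rowLengths μ m) k
  rookNumber≡ferrersRooks μ {m} ℓ≤m k = begin
    rookNumber k μ                      ≡⟨ rookNumber≡rooks k μ ⟩
    rooks k (board μ)                   ≡⟨ cong (rooks k) (board≡cellsOf μ ℓ≤m) ⟩
    rooks k (cellsOf (μ ⟦_⟧) (range 1 m)) ≡⟨ rooks-cellsOf (μ ⟦_⟧) (part-antitone μ) 1 m ≤-refl k ⟩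
    ferrersRooks (rowLengths μ m) k     ∎
    where open ≡-Reasoning

-- The factorisation theorem of Goldman, Joichi and White, in the integer form
-- needed here.
-- Then Z cs does not depend on the order of cs, and
--   Σ_k Z cs k · x (x − 1) ⋯ (x − |cs| + k + 1)  =  ∏_{c ∈ cs} (x + c).
module Factorisation where

  open import Data.Nat as ℕ using (ℕ; zero; suc; s≤s)
  open import Data.Nat.Properties using (m<n⇒m<1+n; ≤-refl)
  open import Data.Integer using (ℤ; +_; 0ℤ; 1ℤ; _+_; _*_; _-_)
  open import Data.Integer.Properties using (+-identityˡ; *-zeroʳ)
  open import Data.Integer.Tactic.RingSolver using (solve-∀)
  open import Data.List using (List; []; _∷_; map; length)
  open import Data.List.Relation.Binary.Permutation.Propositional using (_↭_; refl; prep; swap; trans)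
  open import Data.List.Relation.Binary.Permutation.Propositional.Properties using (↭-length)
  open import Relation.Binary.PropositionalEquality as ≡ using (_≡_; cong; cong₂; sym)

  Z : List ℤ → ℕ → ℤ
  Z cs       zero    = 1ℤ
  Z []       (suc k) = 0ℤ
  Z (c ∷ cs) (suc k) = Z cs (suc k) + (c + + length cs - + k) * Z cs k

  Z-vanish : ∀ cs k → length cs ℕ.< k → Z cs k ≡ 0ℤ
  Z-vanish []       (suc k) _ = ≡.refl
  Z-vanish (c ∷ cs) (suc k) (s≤s |cs|<k)
    rewrite Z-vanish cs (suc k) (m<n⇒m<1+n |cs|<k) | Z-vanish cs k |cs|<k =
    ≡.trans (+-identityˡ _) (*-zeroʳ (c + + length cs - + k))

  -- Exchanging the first two entries is a polynomial identity.
  Z-swap : ∀ c c′ cs k → Z (c ∷ c′ ∷ cs) k ≡ Z (c′ ∷ c ∷ cs) k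
  Z-swap c c′ cs zero          = ≡.refl
  Z-swap c c′ cs (suc zero)    = exchange₁ c c′ (+ length cs) (Z cs 1)
    where
    exchange₁ : ∀ c c′ t z₁ →
      (z₁ + (c′ + t - 0ℤ) * 1ℤ) + (c + (1ℤ + t) - 0ℤ) * 1ℤ ≡ (z₁ + (c + t - 0ℤ) * 1ℤ) + (c′ + (1ℤ + t) - 0ℤ) * 1ℤ
    exchange₁ = solve-∀
  Z-swap c c′ cs (suc (suc k)) = exchange c c′ (+ length cs) (+ k) (Z cs (suc (suc k))) (Z cs (suc k)) (Z cs k)
    where
    exchange : ∀ c c′ t k z₂ z₁ z₀ →
      (z₂ + (c′ + t - (1ℤ + k)) * z₁) + (c + (1ℤ + t) - (1ℤ + k)) * (z₁ + (c′ + t - k) * z₀)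
        ≡ (z₂ + (c + t - (1ℤ + k)) * z₁) + (c′ + (1ℤ + t) - (1ℤ + k)) * (z₁ + (c + t - k) * z₀)
    exchange = solve-∀

  Z-∷ : ∀ c {cs cs′} → length cs ≡ length cs′ → (∀ k → Z cs k ≡ Z cs′ k) → ∀ k → Z (c ∷ cs) k ≡ Z (c ∷ cs′) k
  Z-∷ c same-length same zero    = ≡.refl
  Z-∷ c same-length same (suc k) rewrite same (suc k) | same k | same-length = ≡.refl

  Z-↭ : ∀ {cs cs′} → cs ↭ cs′ → ∀ k → Z cs k ≡ Z cs′ k
  Z-↭ refl                          k = ≡.refl
  Z-↭ (prep c p)                      = Z-∷ c (↭-length p) (Z-↭ p)
  Z-↭ (swap {xs = cs} {ys = cs′} c c′ p) k =
    ≡.trans (Z-swap c c′ cs k) (Z-∷ c′ (cong suc (↭-length p)) (Z-∷ c (↭-length p) (Z-↭ p)) k)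
  Z-↭ (trans p q)                   k = ≡.trans (Z-↭ p k) (Z-↭ q k)

  -- fallingSum t r x = Σ_{k ≤ t} r k · x (x − 1) ⋯ (x − t + k + 1), in Horner form.
  fallingSum : ℕ → (ℕ → ℤ) → ℤ → ℤ
  fallingSum zero    r x = r 0
  fallingSum (suc t) r x = r (suc t) + x * fallingSum t r (x - 1ℤ)

  fallingSum-cong : ∀ t {r s : ℕ → ℤ} → (∀ k → r k ≡ s k) → ∀ x → fallingSum t r x ≡ fallingSum t s x
  fallingSum-cong zero    r≡s x = r≡s 0
  fallingSum-cong (suc t) r≡s x = cong₂ (λ a b → a + x * b) (r≡s (suc t)) (fallingSum-cong t r≡s (x - 1ℤ))

  fallingSum-+ : ∀ t r s x → fallingSum t (λ k → r k + s k) x ≡ fallingSum t r x + fallingSum t s x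
  fallingSum-+ zero    r s x = ≡.refl
  fallingSum-+ (suc t) r s x rewrite fallingSum-+ t r s (x - 1ℤ) =
    distribute (r (suc t)) (s (suc t)) x (fallingSum t r (x - 1ℤ)) (fallingSum t s (x - 1ℤ))
    where
    distribute : ∀ a b x u v → (a + b) + x * (u + v) ≡ (a + x * u) + (b + x * v)
    distribute = solve-∀

  fallingSum-* : ∀ t a r x → fallingSum t (λ k → a * r k) x ≡ a * fallingSum t r x
  fallingSum-* zero    a r x = ≡.refl
  fallingSum-* (suc t) a r x rewrite fallingSum-* t a r (x - 1ℤ) =
    factor a (r (suc t)) x (fallingSum t r (x - 1ℤ))
    where
    factor : ∀ a r x u → a * r + x * (a * u) ≡ a * (r + x * u)
    factor = solve-∀

  shift : (ℕ → ℤ) → ℕ → ℤ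
  shift r zero    = 0ℤ
  shift r (suc k) = r k

  fallingSum-shift : ∀ t r x → fallingSum (suc t) (shift r) x ≡ fallingSum t r x
  fallingSum-shift zero    r x = drop (r 0) x
    where
    drop : ∀ a x → a + x * 0ℤ ≡ a
    drop = solve-∀
  fallingSum-shift (suc t) r x = cong (λ z → r (suc t) + x * z) (fallingSum-shift t r (x - 1ℤ))

  -- Raising the length: x↓(j + 1) = x · x↓j − j · x↓j, termwise.
  fallingSum-suc : ∀ t r x →
    fallingSum (suc t) r x ≡ r (suc t) + x * fallingSum t r x - fallingSum t (λ k → (+ t - + k) * r k) x
  fallingSum-suc zero    r x = lower (r 1) (r 0) x
    where
    lower : ∀ a b x → a + x * b ≡ a + x * b - (0ℤ - 0ℤ) * b
    lower = solve-∀
  fallingSum-suc (suc t) r x = begin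
    r (suc (suc t)) + x * fallingSum (suc t) r (x - 1ℤ)
      ≡⟨ cong (λ z → r (suc (suc t)) + x * z) (fallingSum-suc t r (x - 1ℤ)) ⟩
    r (suc (suc t)) + x * (r (suc t) + (x - 1ℤ) * F - W)
      ≡⟨ regroup (r (suc (suc t))) (r (suc t)) F W x (+ t) ⟩
    r (suc (suc t)) + x * fallingSum (suc t) r x - ((+ suc t - + suc t) * r (suc t) + x * (F + W))
      ≡⟨ cong (λ z → r (suc (suc t)) + x * fallingSum (suc t) r x - ((+ suc t - + suc t) * r (suc t) + x * z)) (sym weights) ⟩
    r (suc (suc t)) + x * fallingSum (suc t) r x - fallingSum (suc t) (λ k → (+ suc t - + k) * r k) x ∎
    where
    open ≡.≡-Reasoning
    F = fallingSum t r (x - 1ℤ)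
    W = fallingSum t (λ k → (+ t - + k) * r k) (x - 1ℤ)
    regroup : ∀ a b F W x t →
      a + x * (b + (x - 1ℤ) * F - W) ≡ a + x * (b + x * F) - (((1ℤ + t) - (1ℤ + t)) * b + x * (F + W))
    regroup = solve-∀
    weights : fallingSum t (λ k → (+ suc t - + k) * r k) (x - 1ℤ) ≡ F + W
    weights = ≡.trans (fallingSum-cong t (λ k → split (+ t) (+ k) (r k)) (x - 1ℤ))
                      (fallingSum-+ t r (λ k → (+ t - + k) * r k) (x - 1ℤ))
      where
      split : ∀ t k r → ((1ℤ + t) - k) * r ≡ r + (t - k) * r
      split = solve-∀

  productℤ : List ℤ → ℤ
  productℤ []       = 1ℤ
  productℤ (c ∷ cs) = c * productℤ cs

  -- The factorisation theorem, by induction on cs: Z (c ∷ cs) is Z cs plus a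
  -- shifted copy of (c + |cs| − k) · Z cs k, and lengthening the falling
  -- factorials of Z cs by one multiplies by x up to a correction cancelled
  -- by that copy.
  fallingSum-Z : ∀ cs x → fallingSum (length cs) (Z cs) x ≡ productℤ (map (_+_ x) cs)
  fallingSum-Z []       x = ≡.refl
  fallingSum-Z (c ∷ cs) x = begin
    fallingSum (suc t) (Z (c ∷ cs)) x
      ≡⟨ fallingSum-cong (suc t) recursion x ⟩
    fallingSum (suc t) (λ k → Z cs k + shift w k) x
      ≡⟨ fallingSum-+ (suc t) (Z cs) (shift w) x ⟩
    fallingSum (suc t) (Z cs) x + fallingSum (suc t) (shift w) x
      ≡⟨ cong₂ _+_ (fallingSum-suc t (Z cs) x) (fallingSum-shift t w x) ⟩
    (Z cs (suc t) + x * P - W) + fallingSum t w x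
      ≡⟨ cong₂ (λ a b → (a + x * P - W) + b) (Z-vanish cs (suc t) ≤-refl) splitW ⟩
    (0ℤ + x * P - W) + (c * P + W)
      ≡⟨ collect x c P W ⟩
    (x + c) * P
      ≡⟨ cong ((x + c) *_) (fallingSum-Z cs x) ⟩
    productℤ (map (_+_ x) (c ∷ cs)) ∎
    where
    open ≡.≡-Reasoning
    t = length cs
    w : ℕ → ℤ
    w k = (c + + t - + k) * Z cs k
    P = fallingSum t (Z cs) x
    W = fallingSum t (λ k → (+ t - + k) * Z cs k) x
    recursion : ∀ k → Z (c ∷ cs) k ≡ Z cs k + shift w k
    recursion zero    = ≡.refl
    recursion (suc k) = ≡.refl
    splitW : fallingSum t w x ≡ c * P + W
    splitW = ≡.trans (fallingSum-cong t (λ k → separate c (+ t) (+ k) (Z cs k)) x)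
                     (≡.trans (fallingSum-+ t _ _ x) (cong (_+ W) (fallingSum-* t c (Z cs) x)))
      where
      separate : ∀ c t k z → (c + t - k) * z ≡ c * z + (t - k) * z
      separate = solve-∀
    collect : ∀ x c P W → (0ℤ + x * P - W) + (c * P + W) ≡ (x + c) * P
    collect = solve-∀

module RookNumbersVia𝒯 where

  open import Data.Nat as ℕ using (ℕ; zero; suc; _∸_; _≤_; _<_; _≥_)
  import Data.Nat.Properties as ℕ
  open import Data.Nat.ListAction using (product)
  open import Data.Integer using (ℤ; +_; _+_; _*_; _-_)
  open import Data.Integer.Properties using (pos-+; pos-*; +-injective; *-zeroʳ; +-comm)
  open import Data.Integer.Tactic.RingSolver using (solve-∀)
  open import Data.List using (List; []; _∷_; map; length)
  open import Data.List.Properties using (length-map; map-∘)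
  open import Data.List.Relation.Unary.All using (All; []; _∷_) renaming (map to mapAll)
  open import Data.List.Relation.Unary.All.Properties using (map⁺)
  open import Data.List.Relation.Unary.AllPairs using (AllPairs; []; _∷_)
  open import Data.List.Relation.Binary.Permutation.Propositional using (_↭_)
  import Data.List.Relation.Binary.Permutation.Propositional.Properties as ↭
  open import Data.Product using (_,_)
  open import Data.Sum using (_⊎_; inj₁; inj₂)
  open import Relation.Binary.PropositionalEquality
  open Basics using (range; length-range; range-bounds; 𝒯; length-𝒯; part-antitone)
  open RookNumbers using (ferrersRooks; Antitone; rowLengths; rookNumber≡ferrersRooks)
  open Factorisation

  lowerRows : List ℕ → List ℤ
  lowerRows []       = []
  lowerRows (b ∷ bs) = (+ b - + length bs) ∷ lowerRows bs

  length-lowerRows : ∀ bs → length (lowerRows bs) ≡ length bs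
  length-lowerRows []       = refl
  length-lowerRows (b ∷ bs) = cong suc (length-lowerRows bs)

  ferrersRooks-vanish : ∀ b bs k → All (ℕ._≤ b) bs → b < k → ferrersRooks bs k ≡ 0
  ferrersRooks-vanish b []        (suc k) _              _   = refl
  ferrersRooks-vanish b (b′ ∷ bs) (suc k) (b′≤b ∷ bs≤b) b<k =
    cong₂ ℕ._+_ (cong (ℕ._* ferrersRooks bs k) (ℕ.m≤n⇒m∸n≡0 (ℕ.≤-trans b′≤b (ℕ.s≤s⁻¹ b<k))))
                (ferrersRooks-vanish b bs (suc k) bs≤b b<k)

  ferrersRooks≡Z : ∀ bs → AllPairs _≥_ bs → ∀ k → + ferrersRooks bs k ≡ Z (lowerRows bs) k
  ferrersRooks≡Z bs       _             zero    = refl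
  ferrersRooks≡Z []       _             (suc k) = refl
  ferrersRooks≡Z (b ∷ bs) (bs≤b ∷ sorted) (suc k) = begin
    + ((b ∸ k) ℕ.* r ℕ.+ r′)               ≡⟨ pos-+ ((b ∸ k) ℕ.* r) r′ ⟩
    + ((b ∸ k) ℕ.* r) + + r′               ≡⟨ +-comm (+ ((b ∸ k) ℕ.* r)) (+ r′) ⟩
    + r′ + + ((b ∸ k) ℕ.* r)               ≡⟨ cong₂ _+_ (ferrersRooks≡Z bs sorted (suc k)) (pos-* (b ∸ k) r) ⟩
    Z (lowerRows bs) (suc k) + + (b ∸ k) * + r ≡⟨ cong (_+_ (Z (lowerRows bs) (suc k))) (coefficient (ℕ.≤-<-connex k b)) ⟩
    Z (lowerRows bs) (suc k) + weight * + r   ≡⟨ cong (λ z → Z (lowerRows bs) (suc k) + weight * z) (ferrersRooks≡Z bs sorted k) ⟩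
    Z (lowerRows (b ∷ bs)) (suc k)           ∎
    where
    open ≡-Reasoning
    ℓ = length bs
    r = ferrersRooks bs k
    r′ = ferrersRooks bs (suc k)
    weight = + b - + ℓ + + length (lowerRows bs) - + k
    -- b ∸ k is the true difference when k ≤ b; otherwise r vanishes
    coefficient : k ℕ.≤ b ⊎ b < k → + (b ∸ k) * + r ≡ weight * + r
    coefficient (inj₁ k≤b) rewrite length-lowerRows bs =
      cong (_* + r) (trans (cancel (+ (b ∸ k)) (+ k) (+ ℓ))
                           (cong (λ z → z - + ℓ + + ℓ - + k) (trans (sym (pos-+ (b ∸ k) k)) (cong +_ (ℕ.m∸n+n≡m k≤b)))))
      where
      cancel : ∀ d k ℓ → d ≡ (d + k) - ℓ + ℓ - k
      cancel = solve-∀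
    coefficient (inj₂ b<k) rewrite ferrersRooks-vanish b bs k bs≤b b<k =
      trans (*-zeroʳ (+ (b ∸ k))) (sym (*-zeroʳ weight))

  rows-sorted : ∀ f → Antitone f → ∀ c n → 1 ≤ c → AllPairs _≥_ (map f (range c n))
  rows-sorted f anti c zero    1≤c = []
  rows-sorted f anti c (suc n) 1≤c =
    map⁺ (mapAll (λ (c<i , _) → anti 1≤c (ℕ.<⇒≤ c<i)) (range-bounds (suc c) n))
      ∷ rows-sorted f anti (suc c) n (ℕ.m≤n⇒m≤1+n 1≤c)

  lowerRows-range : ∀ f d n → lowerRows (map f (range (suc d) n)) ≡ map (λ i → + (i ℕ.+ f i) - + (d ℕ.+ n)) (range (suc d) n)
  lowerRows-range f d zero    = refl
  lowerRows-range f d (suc n) = cong₂ _∷_ top rest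
    where
    top : + f (suc d) - + length (map f (range (suc (suc d)) n)) ≡ + (suc d ℕ.+ f (suc d)) - + (d ℕ.+ suc n)
    top rewrite length-map f (range (suc (suc d)) n) | length-range (suc (suc d)) n
              | pos-+ (suc d) (f (suc d)) | pos-+ d (suc n) = shiftBoth (+ d) (+ f (suc d)) (+ n)
      where
      shiftBoth : ∀ d b n → b - n ≡ (+ 1 + d + b) - (d + (+ 1 + n))
      shiftBoth = solve-∀
    rest : lowerRows (map f (range (suc (suc d)) n)) ≡ map (λ i → + (i ℕ.+ f i) - + (d ℕ.+ suc n)) (range (suc (suc d)) n)
    rest rewrite ℕ.+-suc d n = lowerRows-range f (suc d) n

  lowered : ℕ → List ℕ → List ℤ
  lowered m = map (λ a → + a - + m)

  rookNumber≡Z : ∀ μ {m} → len μ ≤ m → ∀ k → + rookNumber k μ ≡ Z (lowered m (𝒯 μ m)) k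
  rookNumber≡Z μ {m} ℓ≤m k = begin
    + rookNumber k μ                           ≡⟨ cong +_ (rookNumber≡ferrersRooks μ ℓ≤m k) ⟩
    + ferrersRooks (rowLengths μ m) k          ≡⟨ ferrersRooks≡Z (rowLengths μ m) (rows-sorted (μ ⟦_⟧) (part-antitone μ) 1 m ℕ.≤-refl) k ⟩
    Z (lowerRows (rowLengths μ m)) k           ≡⟨ cong (λ cs → Z cs k) (trans (lowerRows-range (μ ⟦_⟧) 0 m) (map-∘ (range 1 m))) ⟩
    Z (lowered m (𝒯 μ m)) k                    ∎
    where open ≡-Reasoning

  𝒯↭⇒rookEquivalent : ∀ μ ν {m} → len μ ≤ m → len ν ≤ m → 𝒯 μ m ↭ 𝒯 ν m → RookEquivalent μ ν
  𝒯↭⇒rookEquivalent μ ν ℓμ≤m ℓν≤m 𝒯μ↭𝒯ν k =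
    +-injective (trans (rookNumber≡Z μ ℓμ≤m k)
                (trans (Z-↭ (↭.map⁺ _ 𝒯μ↭𝒯ν) k) (sym (rookNumber≡Z ν ℓν≤m k))))

  -- At x = m + y the factors x + (a − m) are the natural numbers y + a.
  productℤ-lowered : ∀ m y T → productℤ (map (_+_ (+ (m ℕ.+ y))) (lowered m T)) ≡ + product (map (y ℕ.+_) T)
  productℤ-lowered m y []      = refl
  productℤ-lowered m y (a ∷ T) = begin
    (+ (m ℕ.+ y) + (+ a - + m)) * productℤ (map (_+_ (+ (m ℕ.+ y))) (lowered m T))
      ≡⟨ cong₂ _*_ factor (productℤ-lowered m y T) ⟩
    + (y ℕ.+ a) * + product (map (y ℕ.+_) T)
      ≡⟨ sym (pos-* (y ℕ.+ a) _) ⟩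
    + product (map (y ℕ.+_) (a ∷ T)) ∎
    where
    open ≡-Reasoning
    factor : + (m ℕ.+ y) + (+ a - + m) ≡ + (y ℕ.+ a)
    factor rewrite pos-+ m y | pos-+ y a = cancel (+ m) (+ y) (+ a)
      where
      cancel : ∀ m y a → m + y + (a - m) ≡ y + a
      cancel = solve-∀

  factorisation : ∀ μ {m} → len μ ≤ m → ∀ y →
    + product (map (y ℕ.+_) (𝒯 μ m)) ≡ fallingSum m (λ k → + rookNumber k μ) (+ (m ℕ.+ y))
  factorisation μ {m} ℓ≤m y = begin
    + product (map (y ℕ.+_) (𝒯 μ m))              ≡⟨ sym (productℤ-lowered m y (𝒯 μ m)) ⟩
    productℤ (map (_+_ x) cs)                      ≡⟨ sym (fallingSum-Z cs x) ⟩
    fallingSum (length cs) (Z cs) x                ≡⟨ cong (λ t → fallingSum t (Z cs) x) length-cs ⟩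
    fallingSum m (Z cs) x                          ≡⟨ fallingSum-cong m (λ k → sym (rookNumber≡Z μ ℓ≤m k)) x ⟩
    fallingSum m (λ k → + rookNumber k μ) x        ∎
    where
    open ≡-Reasoning
    x = + (m ℕ.+ y)
    cs = lowered m (𝒯 μ m)
    length-cs : length cs ≡ m
    length-cs = trans (length-map _ (𝒯 μ m)) (length-𝒯 μ m)

  rookEquivalent⇒products : ∀ μ ν {m} → len μ ≤ m → len ν ≤ m → RookEquivalent μ ν → ∀ y →
    product (map (y ℕ.+_) (𝒯 μ m)) ≡ product (map (y ℕ.+_) (𝒯 ν m))
  rookEquivalent⇒products μ ν {m} ℓμ≤m ℓν≤m r≡ y = +-injective (begin
    + product (map (y ℕ.+_) (𝒯 μ m))                  ≡⟨ factorisation μ ℓμ≤m y ⟩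
    fallingSum m (λ k → + rookNumber k μ) (+ (m ℕ.+ y)) ≡⟨ fallingSum-cong m (λ k → cong +_ (r≡ k)) _ ⟩
    fallingSum m (λ k → + rookNumber k ν) (+ (m ℕ.+ y)) ≡⟨ sym (factorisation ν ℓν≤m y) ⟩
    + product (map (y ℕ.+_) (𝒯 ν m))                  ∎)
    where open ≡-Reasoning

-- A finite multiset A of naturals is determined by the products
-- ∏_{a ∈ A} (y + 1 + a), y ∈ ℕ: for a prime p larger than everything
-- involved and y + 1 + a = p, the prime p must divide, hence equal, a
-- factor y + 1 + b of the other product, whence b = a.
module ProductsDetermineMultisets where

  open import Data.Nat
  open import Data.Nat.Properties
  open import Data.Nat.Divisibility
  open import Data.Nat.Primality using (Prime; prime⇒nonTrivial; euclidsLemma)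
  open import Data.Nat.Primality.Factorisation using (factorise)
  open import Data.Nat.ListAction using (product; sum)
  open import Data.Nat.ListAction.Properties using (product-↭)
  open import Data.List using (List; []; _∷_; map; _++_)
  open import Data.List.Relation.Unary.All using (_∷_)
  open import Data.List.Relation.Unary.Any using (Any; here; there)
  open import Data.List.Relation.Unary.Any.Properties using (map⁻)
  open import Data.List.Membership.Propositional using (_∈_; find)
  open import Data.List.Membership.Propositional.Properties using (∈-∃++)
  open import Data.List.Relation.Binary.Permutation.Propositional using (_↭_; ↭-refl; ↭-sym; ↭-trans; prep)
  open import Data.List.Relation.Binary.Permutation.Propositional.Properties using (shift) renaming (map⁺ to ↭-map⁺)
  open import Data.Product using (∃-syntax; _×_; _,_)
  open import Data.Sum using (inj₁; inj₂)
  open import Relation.Nullary using (yes; no)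
  open import Relation.Nullary.Negation using (contradiction)
  open import Relation.Binary.PropositionalEquality

  prime>1 : ∀ {p} → Prime p → 1 < p
  prime>1 {p} p-prime = nonTrivial⇒n>1 p {{prime⇒nonTrivial p-prime}}

  -- Euclid: a prime factor of N! + 1 exceeds N.
  primeAbove : ∀ N → ∃[ p ] (Prime p × N < p)
  primeAbove N with factorise (suc (N !))
  ... | record { factors = [] ; isFactorisation = N!+1≡1 } =
    contradiction (suc-injective N!+1≡1) (≢-nonZero⁻¹ (N !) {{N !≢0}})
  ... | record { factors = p ∷ ps ; isFactorisation = N!+1≡p*ps ; factorsPrime = p-prime ∷ _ } with N <? p
  ...   | yes N<p = p , p-prime , N<p
  ...   | no  N≮p = contradiction (∣1⇒≡1 (∣m+n∣m⇒∣n p∣N!+1 p∣N!)) (>⇒≢ (prime>1 p-prime))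
    where
    p∣N!+1 : p ∣ N ! + 1
    p∣N!+1 = subst (p ∣_) (trans (sym N!+1≡p*ps) (+-comm 1 (N !))) (m∣m*n (product ps))
    p∣p! : ∀ p → 1 ≤ p → p ∣ p !
    p∣p! (suc q) _ = m∣m*n (q !)
    p∣N! : p ∣ N !
    p∣N! = ∣-trans (p∣p! p (<⇒≤ (prime>1 p-prime))) (m≤n⇒m!∣n! (≮⇒≥ N≮p))

  prime∣product : ∀ {p} → Prime p → ∀ xs → p ∣ product xs → Any (p ∣_) xs
  prime∣product p-prime []       p∣1 = contradiction (∣1⇒≡1 p∣1) (>⇒≢ (prime>1 p-prime))
  prime∣product p-prime (x ∷ xs) p∣x*xs with euclidsLemma x (product xs) p-prime p∣x*xs
  ... | inj₁ p∣x  = here p∣x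
  ... | inj₂ p∣xs = there (prime∣product p-prime xs p∣xs)

  multiple-below-double : ∀ p n → 0 < n → n < p + p → p ∣ n → n ≡ p
  multiple-below-double p n 0<n n<2p (divides zero          n≡0) = contradiction n≡0 (>⇒≢ 0<n)
  multiple-below-double p n 0<n n<2p (divides (suc zero)    n≡p) = trans n≡p (+-identityʳ p)
  multiple-below-double p n 0<n n<2p (divides (suc (suc q)) n≡) =
    contradiction (≤-trans (+-monoʳ-≤ p (m≤m+n p (q * p))) (≤-reflexive (sym n≡))) (<⇒≱ n<2p)

  ∈⇒≤sum : ∀ {x xs} → x ∈ xs → x ≤ sum xs
  ∈⇒≤sum {xs = x ∷ xs} (here refl) = m≤m+n x (sum xs)
  ∈⇒≤sum {xs = x ∷ xs} (there x∈) = ≤-trans (∈⇒≤sum x∈) (m≤n+m (sum xs) x)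

  shiftedProduct : ℕ → List ℕ → ℕ
  shiftedProduct y A = product (map (suc y +_) A)

  shared-factor : ∀ a A B → (∀ y → shiftedProduct y (a ∷ A) ≡ shiftedProduct y B) → a ∈ B
  shared-factor a A B same with primeAbove (a + sum B)
  ... | p , p-prime , big =
    let (b , b∈B , p∣y+1+b) = find (map⁻ (prime∣product p-prime (map (suc y +_) B) p∣B)) in
    subst (_∈ B) (factor≡p⇒b≡a b∈B p∣y+1+b) b∈B
    where
    y = p ∸ suc a
    y+1+a≡p : suc y + a ≡ p
    y+1+a≡p = trans (sym (+-suc y a)) (m∸n+n≡m (≤-trans (s≤s (m≤m+n a (sum B))) big))
    p∣B : p ∣ shiftedProduct y B
    p∣B = subst (p ∣_) (same y) (subst (λ z → p ∣ z * shiftedProduct y A) (sym y+1+a≡p) (m∣m*n _))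
    factor≡p⇒b≡a : ∀ {b} → b ∈ B → p ∣ suc y + b → b ≡ a
    factor≡p⇒b≡a {b} b∈B p∣y+1+b = +-cancelˡ-≡ (suc y) b a
      (trans (multiple-below-double p (suc y + b) (s≤s z≤n) y+1+b<2p p∣y+1+b) (sym y+1+a≡p))
      where
      y+1+b<2p : suc y + b < p + p
      y+1+b<2p = +-mono-≤-< (subst (suc y ≤_) y+1+a≡p (m≤m+n (suc y) a))
                            (≤-<-trans (∈⇒≤sum b∈B) (≤-<-trans (m≤n+m (sum B) a) big))

  products-determine : ∀ A B → (∀ y → shiftedProduct y A ≡ shiftedProduct y B) → A ↭ B
  products-determine []      []      _    = ↭-refl
  products-determine []      (b ∷ B) same with () ← shared-factor b B [] (λ y → sym (same y))
  products-determine (a ∷ A) B       same with ∈-∃++ (shared-factor a A B same)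
  ... | xs , ys , refl =
    ↭-trans (prep a (products-determine A (xs ++ ys) same′)) (↭-sym (shift a xs ys))
    where
    same′ : ∀ y → shiftedProduct y A ≡ shiftedProduct y (xs ++ ys)
    same′ y = *-cancelˡ-≡ _ _ (suc y + a)
      (trans (same y) (product-↭ (↭-map⁺ (suc y +_) (shift a xs ys))))

-- 𝒯 μ m splits as 𝒮 μ together with the interval [c, …, m], c = min 𝒯 μ m:
-- reading the rows from the bottom, a row i that is not salient has
-- i + μ_i smaller than every later value, and then exactly one smaller than
-- their minimum (as i + 1 + μ_{i+1} ≤ i + μ_i + 1), so the non-salient values
-- form an interval ending at m.
module SalientDecomposition where

  open import Data.Nat
  open import Data.Nat.Properties
  open import Data.List using (List; []; _∷_; _++_; map; filter; length)
  open import Data.List.Properties using (filter-accept; filter-reject; filter-none; filter-++; ++-identityʳ; length-++)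
  open import Data.List.Relation.Unary.All using (All; lookup) renaming (map to mapAll)
  open import Data.List.Relation.Unary.All.Properties using (map⁺)
  open import Data.List.Relation.Unary.Any using (here)
  open import Data.List.Membership.Propositional using (_∈_)
  open import Data.List.Membership.Propositional.Properties using (∈-++⁺ʳ)
  open import Data.List.Relation.Binary.Permutation.Propositional using (_↭_; ↭-refl; ↭-sym; ↭-trans; prep)
  open import Data.List.Relation.Binary.Permutation.Propositional.Properties using (shift; ∈-resp-↭; ++⁺ʳ; ++-comm; drop-∷; ↭-length)
  open import Data.Product using (∃-syntax; _×_; _,_)
  open import Function.Bundles using (_⇔_; mk⇔)
  open import Relation.Nullary using (yes; no; ¬_)
  open import Relation.Binary.PropositionalEquality
  open Basics using (range; range-bounds; range-split; length-range; oneTo≡range; 𝒯; length-𝒯; part-beyond; part-antitone)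

  record Decomposition (μ : Partition) (m : ℕ) : Set where
    field
      start width : ℕ
      spans       : start + width ≡ suc m
      nonempty    : 1 ≤ width
      split       : 𝒯 μ m ↭ 𝒮 μ ++ range start width
      minimal     : All (start ≤_) (𝒯 μ m)

  ++-cancelˡ : ∀ (xs : List ℕ) {ys zs} → xs ++ ys ↭ xs ++ zs → ys ↭ zs
  ++-cancelˡ []       p = p
  ++-cancelˡ (x ∷ xs) p = ++-cancelˡ xs (drop-∷ p)

  ++-cancelʳ : ∀ {xs ys} (zs : List ℕ) → xs ++ zs ↭ ys ++ zs → xs ↭ ys
  ++-cancelʳ {xs} {ys} zs p = ++-cancelˡ zs (↭-trans (++-comm zs xs) (↭-trans p (++-comm ys zs)))

  module _ {μ m} (D : Decomposition μ m) where
    open Decomposition D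

    -- The interval is nonempty, so its start is the minimum of 𝒯 μ m.
    start∈𝒯 : start ∈ 𝒯 μ m
    start∈𝒯 = ∈-resp-↭ (↭-sym split) (∈-++⁺ʳ (𝒮 μ) (head∈ width nonempty))
      where
      head∈ : ∀ w → 1 ≤ w → start ∈ range start w
      head∈ (suc w) _ = here refl

    length-𝒮 : length (𝒮 μ) + width ≡ m
    length-𝒮 = begin
      length (𝒮 μ) + width                      ≡⟨ cong (length (𝒮 μ) +_) (sym (length-range start width)) ⟩
      length (𝒮 μ) + length (range start width) ≡⟨ sym (length-++ (𝒮 μ)) ⟩
      length (𝒮 μ ++ range start width)         ≡⟨ sym (↭-length split) ⟩
      length (𝒯 μ m)                            ≡⟨ length-𝒯 μ m ⟩
      m                                         ∎
      where open ≡-Reasoning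

  𝒯↭⇔𝒮↭ : ∀ {μ ν m} → Decomposition μ m → Decomposition ν m → ((𝒯 μ m ↭ 𝒯 ν m) ⇔ (𝒮 μ ↭ 𝒮 ν))
  𝒯↭⇔𝒮↭ {μ} {ν} {m} Dμ Dν = mk⇔ to from
    where
    module Dμ = Decomposition Dμ
    module Dν = Decomposition Dν

    -- both intervals end at m, so their starts determine them
    sameInterval : Dμ.start ≡ Dν.start → range Dμ.start Dμ.width ≡ range Dν.start Dν.width
    sameInterval starts = cong₂ range starts
      (+-cancelˡ-≡ Dν.start _ _ (trans (cong (_+ Dμ.width) (sym starts)) (trans Dμ.spans (sym Dν.spans))))

    to : 𝒯 μ m ↭ 𝒯 ν m → 𝒮 μ ↭ 𝒮 ν
    to 𝒯↭ = ++-cancelʳ (range Dν.start Dν.width)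
      (↭-trans (subst (λ I → 𝒮 μ ++ I ↭ 𝒯 μ m) (sameInterval starts) (↭-sym Dμ.split)) (↭-trans 𝒯↭ Dν.split))
      where
      -- both starts are the minimum of the same multiset
      starts : Dμ.start ≡ Dν.start
      starts = ≤-antisym (lookup Dμ.minimal (∈-resp-↭ (↭-sym 𝒯↭) (start∈𝒯 Dν)))
                         (lookup Dν.minimal (∈-resp-↭ 𝒯↭ (start∈𝒯 Dμ)))

    from : 𝒮 μ ↭ 𝒮 ν → 𝒯 μ m ↭ 𝒯 ν m
    from 𝒮↭ = ↭-trans Dμ.split
      (↭-trans (++⁺ʳ _ 𝒮↭) (subst (λ I → 𝒮 ν ++ I ↭ 𝒯 ν m) (sym (sameInterval starts)) (↭-sym Dν.split)))
      where
      -- both intervals fill up m entries with the salient ones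
      widths : Dμ.width ≡ Dν.width
      widths = +-cancelˡ-≡ (length (𝒮 μ)) _ _
        (trans (length-𝒮 Dμ) (trans (sym (length-𝒮 Dν)) (cong (_+ Dν.width) (sym (↭-length 𝒮↭)))))
      starts : Dμ.start ≡ Dν.start
      starts = +-cancelʳ-≡ Dμ.width _ _ (trans Dμ.spans (trans (sym Dν.spans) (cong (Dν.start +_) (sym widths))))

  module Construction (μ : Partition) (m : ℕ) (ℓ<m : len μ < m) where

    τ : ℕ → ℕ
    τ i = i + μ ⟦ i ⟧

    τ-beyond : ∀ {j} → len μ < j → τ j ≡ j
    τ-beyond {j} ℓ<j = trans (cong (j +_) (part-beyond μ ℓ<j)) (+-identityʳ j)

    τ-step : ∀ i → τ (suc (suc i)) ≤ suc (τ (suc i))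
    τ-step i = s≤s (+-monoʳ-≤ (suc i) (part-antitone μ (s≤s z≤n) (n≤1+n (suc i))))

    nonsalient-beyond : ∀ {j} → len μ < j → ¬ Salient μ j
    nonsalient-beyond {j} ℓ<j (k , j<k , τk≤τj) =
      <⇒≱ j<k (≤-trans (m≤m+n k (μ ⟦ k ⟧)) (≤-trans τk≤τj (≤-reflexive (τ-beyond ℓ<j))))

    record Suffix (d n : ℕ) : Set where
      field
        start width : ℕ
        spans    : start + width ≡ suc m
        split    : map τ (range (suc d) n) ↭ map τ (filter (salient? μ) (range (suc d) n)) ++ range start width
        below    : ∀ {j} → d < j → start ≤ τ j
        attained : ∃[ j ] (d < j × τ j ≡ start)

    -- No rows: the minimum of τ beyond m is τ (m + 1) = m + 1.
    empty-suffix : ∀ d → d ≡ m → Suffix d 0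
    empty-suffix d refl = record
      { start = suc m ; width = 0 ; spans = +-identityʳ (suc m) ; split = ↭-refl
      ; below = λ {j} m<j → ≤-trans m<j (m≤m+n j (μ ⟦ j ⟧))
      ; attained = suc m , ≤-refl , τ-beyond (m<n⇒m<1+n ℓ<m) }

    -- A salient row is at least the current minimum: it joins 𝒮.
    add-salient : ∀ {d n} → Salient μ (suc d) → Suffix (suc d) n → Suffix d (suc n)
    add-salient {d} {n} (k , d+1<k , τk≤) S = record
      { start = start ; width = width ; spans = spans
      ; split = subst (λ rs → map τ (range (suc d) (suc n)) ↭ map τ rs ++ range start width)
                      (sym (filter-accept (salient? μ) (k , d+1<k , τk≤))) (prep (τ (suc d)) split)
      ; below = below′
      ; attained = let (j , d+1<j , τj≡) = attained in j , <⇒≤ d+1<j , τj≡ }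
      where
      open Suffix S
      below′ : ∀ {j} → d < j → start ≤ τ j
      below′ {j} d<j with suc d ≟ j
      ... | yes refl = ≤-trans (below d+1<k) τk≤
      ... | no  d+1≢j = below (≤∧≢⇒< d<j d+1≢j)

    -- A non-salient row lies below the current minimum, hence just below it:
    -- it extends the interval downwards.
    add-nonsalient : ∀ {d n} → ¬ Salient μ (suc d) → Suffix (suc d) n → Suffix d (suc n)
    add-nonsalient {d} {n} nonsalient S = record
      { start = τ (suc d) ; width = suc width
      ; spans = trans (+-suc (τ (suc d)) width) (trans (cong (_+ width) (sym start≡)) spans)
      ; split = subst (λ rs → map τ (range (suc d) (suc n)) ↭ map τ rs ++ range (τ (suc d)) (suc width))
                      (sym (filter-reject (salient? μ) nonsalient)) split′
      ; below = below′
      ; attained = suc d , ≤-refl , refl }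
      where
      open Suffix S
      τ<start : τ (suc d) < start
      τ<start = ≰⇒> (λ start≤τ → let (j , d+1<j , τj≡) = attained in
                       nonsalient (j , d+1<j , subst (_≤ τ (suc d)) (sym τj≡) start≤τ))
      start≡ : start ≡ suc (τ (suc d))
      start≡ = ≤-antisym (≤-trans (below ≤-refl) (τ-step d)) τ<start
      split′ : map τ (range (suc d) (suc n))
               ↭ map τ (filter (salient? μ) (range (suc (suc d)) n)) ++ range (τ (suc d)) (suc width)
      split′ = ↭-trans (prep (τ (suc d)) (subst (λ c → _ ↭ _ ++ range c width) start≡ split))
                       (↭-sym (shift (τ (suc d)) _ (range (suc (τ (suc d))) width)))
      below′ : ∀ {j} → d < j → τ (suc d) ≤ τ j
      below′ {j} d<j with suc d ≟ j
      ... | yes refl = ≤-refl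
      ... | no  d+1≢j = <⇒≤ (<-≤-trans τ<start (below (≤∧≢⇒< d<j d+1≢j)))

    suffix : ∀ d n → d + n ≡ m → Suffix d n
    suffix d zero    d+0≡m = empty-suffix d (trans (sym (+-identityʳ d)) d+0≡m)
    suffix d (suc n) d+n≡m with salient? μ (suc d)
    ... | yes salient    = add-salient salient rest
      where rest = suffix (suc d) n (trans (sym (+-suc d n)) d+n≡m)
    ... | no  nonsalient = add-nonsalient nonsalient rest
      where rest = suffix (suc d) n (trans (sym (+-suc d n)) d+n≡m)

    salient-rows : filter (salient? μ) (range 1 m) ≡ filter (salient? μ) (oneTo (len μ))
    salient-rows = begin
      filter salientRow? (range 1 m)                                    ≡⟨ cong (filter salientRow?) (range-split (<⇒≤ ℓ<m)) ⟩
      filter salientRow? (range 1 ℓ ++ range (suc ℓ) (m ∸ ℓ))           ≡⟨ filter-++ salientRow? (range 1 ℓ) _ ⟩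
      filter salientRow? (range 1 ℓ) ++ filter salientRow? (range (suc ℓ) (m ∸ ℓ)) ≡⟨ cong (filter salientRow? (range 1 ℓ) ++_) none ⟩
      filter salientRow? (range 1 ℓ) ++ []                              ≡⟨ ++-identityʳ _ ⟩
      filter salientRow? (range 1 ℓ)                                    ≡⟨ cong (filter salientRow?) (sym (oneTo≡range ℓ)) ⟩
      filter salientRow? (oneTo ℓ)                                      ∎
      where
      open ≡-Reasoning
      ℓ = len μ
      salientRow? = salient? μ
      none : filter salientRow? (range (suc ℓ) (m ∸ ℓ)) ≡ []
      none = filter-none salientRow? (mapAll (λ (ℓ<j , _) → nonsalient-beyond ℓ<j) (range-bounds (suc ℓ) (m ∸ ℓ)))

    -- All rows 1, …, m; the start is at most τ m = m, so the interval is nonempty.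
    decomposition : Decomposition μ m
    decomposition = record
      { start = start ; width = width ; spans = spans
      ; nonempty = ≰⇒> (λ width≤0 → 1+n≰n (subst (_≤ m) (start≡ width≤0) start≤m))
      ; split = subst (λ rs → 𝒯 μ m ↭ map τ rs ++ range start width) salient-rows split
      ; minimal = map⁺ (mapAll (λ (1≤i , _) → below 1≤i) (range-bounds 1 m)) }
      where
      open Suffix (suffix 0 m refl)
      start≤m : start ≤ m
      start≤m = ≤-trans (below (≤-trans (s≤s z≤n) ℓ<m)) (≤-reflexive (τ-beyond ℓ<m))
      start≡ : width ≤ 0 → start ≡ suc m
      start≡ width≤0 = trans (sym (+-identityʳ start)) (trans (cong (start +_) (sym (n≤0⇒n≡0 width≤0))) spans)

  decompose : ∀ μ {m} → len μ < m → Decomposition μ m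
  decompose μ {m} ℓ<m = Construction.decomposition μ m ℓ<m

open import Data.Nat using (suc; _+_; _≤_; _<_; s≤s)
open import Data.Nat.Properties using (<⇒≤; m≤m+n; m≤n+m)
open import Function.Bundles using (mk⇔)
import Function.Properties.Equivalence as Equivalence
open Basics using (𝒯)
open RookNumbersVia𝒯 using (rookEquivalent⇒products; 𝒯↭⇒rookEquivalent)
open ProductsDetermineMultisets using (products-determine)
open SalientDecomposition using (𝒯↭⇔𝒮↭; decompose)

rookEquivalent⇔𝒯↭ : ∀ μ ν {m} → len μ ≤ m → len ν ≤ m → (RookEquivalent μ ν ⇔ (𝒯 μ m ↭ 𝒯 ν m))
rookEquivalent⇔𝒯↭ μ ν {m} ℓμ≤m ℓν≤m = mk⇔
  (λ r≡ → products-determine (𝒯 μ m) (𝒯 ν m) (λ y → rookEquivalent⇒products μ ν ℓμ≤m ℓν≤m r≡ (suc y)))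
  (𝒯↭⇒rookEquivalent μ ν ℓμ≤m ℓν≤m)

rookEquivalent⇔𝒮↭ : ∀ μ ν → (RookEquivalent μ ν ⇔ (𝒮 μ ↭ 𝒮 ν))
rookEquivalent⇔𝒮↭ μ ν =
  Equivalence.trans (rookEquivalent⇔𝒯↭ μ ν (<⇒≤ ℓμ<m) (<⇒≤ ℓν<m))
                    (𝒯↭⇔𝒮↭ (decompose μ ℓμ<m) (decompose ν ℓν<m))
  where
  m = suc (len μ + len ν)
  ℓμ<m : len μ < m
  ℓμ<m = s≤s (m≤m+n (len μ) (len ν))
  ℓν<m : len ν < m
  ℓν<m = s≤s (m≤n+m (len ν) (len μ))

theorem15 : (n : ℕ) (μ ν : Partition) → μ ⊢ n → ν ⊢ n →
    (RookEquivalent μ ν ⇔ (𝒮 μ ↭ 𝒮 ν))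
theorem15 _ μ ν _ _ = rookEquivalent⇔𝒮↭ μ ν
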